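{- If $T$ is a tree with at least $3$ vertices and $n\ge 1$, then $\mu_{\rm t}(T\,\square\,K_n)=n\cdot\mu_{\rm t}(T)$.
   Context: $K_n$ is the complete graph on $n$ vertices. The Cartesian product $G\,\square\,H$ has vertex set $V(G)\times V(H)$, with $(g,h)$ adjacent to $(g',h')$ iff either $gg'\in E(G)$ and $h=h'$, or $g=g'$ and $hh'\in E(H)$. For a connected graph $G$ and $X\subseteq V(G)$, two vertices $x,y$ are $X$-visible if there is a shortest $x,y$-path $P$ with $V(P)\cap X\subseteq\{x,y\}$; $X$ is a total mutual-visibility set if every pair of vertices of $G$ is $X$-visible. $\mu_{\rm t}(G)$ is the largest cardinality of a total mutual-visibility set of $G$. -}

module Defs where

open import Data.Nat using (ℕ; zero; suc; _≤_; _+_)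
open import Data.Fin using (Fin; remQuot; _≟_)
open import Data.Fin.Subset using (Subset; _∈_; ∣_∣)
open import Data.Bool using (Bool; true; false; _∧_; _∨_; not)
open import Data.Product using (_×_; _,_; Σ; ∃)
open import Data.Sum using (_⊎_)
open import Data.List using (List; []; _∷_)
open import Data.List.Relation.Unary.All using (All)
open import Data.List.Relation.Unary.Unique.Propositional using (Unique)
open import Relation.Binary.PropositionalEquality using (_≡_)
open import Relation.Nullary using (¬_)
open import Relation.Nullary.Decidable using (⌊_⌋)

Graph : ℕ → Set
Graph v = Fin v → Fin v → Bool

IsSimple : ∀ {v} → Graph v → Set
IsSimple {v} G = (∀ (x y : Fin v) → G x y ≡ G y x) × (∀ (x : Fin v) → G x x ≡ false)

data Walk {v} (G : Graph v) : Fin v → Fin v → Set where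
  []  : ∀ {x} → Walk G x x
  _∷_ : ∀ {x y z} → G x y ≡ true → Walk G y z → Walk G x z

length : ∀ {v} {G : Graph v} {x y} → Walk G x y → ℕ
length []      = 0
length (_ ∷ w) = suc (length w)

verts : ∀ {v} {G : Graph v} {x y} → Walk G x y → List (Fin v)
verts {x = x} []      = x ∷ []
verts {x = x} (_ ∷ w) = x ∷ verts w

IsShortest : ∀ {v} {G : Graph v} {x y} → Walk G x y → Set
IsShortest {G = G} {x} {y} w = ∀ (w' : Walk G x y) → length w ≤ length w'

Connected : ∀ {v} → Graph v → Set
Connected {v} G = ∀ (x y : Fin v) → Walk G x y

verts-tail : ∀ {v} {G : Graph v} {x y} → Walk G x y → List (Fin v)
verts-tail []      = []
verts-tail (_ ∷ w) = verts w

IsCycle : ∀ {v} {G : Graph v} {x} → Walk G x x → Set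
IsCycle w = (3 ≤ length w) × Unique (verts-tail w)

Acyclic : ∀ {v} → Graph v → Set
Acyclic {v} G = ∀ (x : Fin v) (w : Walk G x x) → ¬ IsCycle w

IsTree : ∀ {v} → Graph v → Set
IsTree G = IsSimple G × Connected G × Acyclic G

K : (n : ℕ) → Graph n
K n i j = not ⌊ i ≟ j ⌋

-- Cartesian product G □ H, vertex (g , h) encoded as combine g h : Fin (v * n)
_□_ : ∀ {v n} → Graph v → Graph n → Graph (v Data.Nat.* n)
_□_ {v} {n} G H p q with remQuot {v} n p | remQuot {v} n q
... | (g , h) | (g' , h') = (G g g' ∧ ⌊ h ≟ h' ⌋) ∨ (⌊ g ≟ g' ⌋ ∧ H h h')

Visible : ∀ {v} → Graph v → Subset v → Fin v → Fin v → Set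
Visible G X x y =
  Σ (Walk G x y) λ P → IsShortest P × All (λ u → u ∈ X → (u ≡ x) ⊎ (u ≡ y)) (verts P)

IsTotalMutualVisibility : ∀ {v} → Graph v → Subset v → Set
IsTotalMutualVisibility {v} G X = ∀ (x y : Fin v) → Visible G X x y

IsMuT : ∀ {v} → Graph v → ℕ → Set
IsMuT {v} G k =
  (Σ (Subset v) λ X → IsTotalMutualVisibility G X × ∣ X ∣ ≡ k)
  × (∀ (X : Subset v) → IsTotalMutualVisibility G X → ∣ X ∣ ≤ k)

-- In a tree with at least three vertices a total mutual-visibility set X is independent: if
-- x, y ∈ X were adjacent, a walk from a third vertex enters {x, y} through an edge zx, say,
-- with z ∉ {x, y}, and then y x z is the only shortest y,z-path although x ∈ X.
-- For an independent total mutual-visibility set X of a graph G, X × V(K_n) is a total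
-- mutual-visibility set of G □ K_n: inside a G-layer copy a visible path of G; between layers
-- change layer exactly once, at x if x ∉ X and otherwise at the successor of x on the path,
-- which independence keeps out of X. Conversely, shortest paths between two vertices of a
-- G-layer never leave it, so each G-layer of a total mutual-visibility set of G □ K_n is one
-- of G, and summing over the n layers gives the upper bound.

module Submission where

open import Defs
open import Data.Nat using (ℕ; zero; suc; _+_; _*_; _≤_; _<_; z≤n; s≤s)
open import Data.Nat.Properties
  using ( +-0-commutativeMonoid; +-assoc; +-mono-≤; ≤-refl; ≤-reflexive; ≤-trans; <⇒≤; <⇒≱; ≤-<-trans
        ; m<n⇒m<1+n; m≤n⇒m≤1+n)
open import Algebra.Properties.CommutativeMonoid.Sum +-0-commutativeMonoid
  using (sum-syntax; ∑-comm; sum-cong-≗)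
open import Data.Bool using (Bool; true; false; _∧_; _∨_; not; if_then_else_)
open import Data.Bool.Properties using (∨-zeroʳ)
open import Data.Fin using (Fin; zero; suc; _↑ˡ_; _↑ʳ_; combine; remQuot; _≟_; punchIn; punchOut)
open import Data.Fin.Properties
  using (remQuot-combine; combine-remQuot; combine-injectiveˡ; punchInᵢ≢i; punchIn-injective; punchIn-punchOut)
open import Data.Fin.Subset using (Subset; _∈_; ∣_∣)
open import Data.Fin.Subset.Properties using (_∈?_)
open import Data.Vec using ([]; _∷_; lookup; tabulate)
open import Data.Vec.Properties using ([]=⇒lookup; lookup⇒[]=; lookup∘tabulate; tabulate∘lookup; tabulate-cong)
open import Data.List using ([]; _∷_; map)
open import Data.List.Membership.Propositional using () renaming (_∈_ to _∈ₗ_; _∉_ to _∉ₗ_)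
open import Data.List.Relation.Unary.Any using (here; there)
open import Data.List.Relation.Unary.All as All using (All; []; _∷_)
open import Data.List.Relation.Unary.All.Properties using (map⁺)
open import Data.List.Relation.Unary.AllPairs using ([]; _∷_)
open import Data.Product using (_×_; _,_; proj₁; proj₂; Σ; ∃; ∃₂; uncurry)
open import Data.Sum using (_⊎_; inj₁; inj₂; [_,_]′)
import Data.Sum as Sum
open import Data.Empty using (⊥; ⊥-elim)
open import Function using (_∘_; id)
open import Relation.Binary.PropositionalEquality
open import Relation.Nullary using (¬_; yes; no)
open import Relation.Nullary.Decidable using (⌊_⌋; _⊎-dec_)
open import Relation.Unary using (Pred; Decidable)

∑-const : ∀ n c → ∑[ i < n ] c ≡ n * c
∑-const zero    c = refl
∑-const (suc n) c = cong (c +_) (∑-const n c)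

∑-≤ : ∀ {n k} (f : Fin n → ℕ) → (∀ i → f i ≤ k) → ∑[ i < n ] f i ≤ n * k
∑-≤ {zero}  f f≤k = z≤n
∑-≤ {suc n} f f≤k = +-mono-≤ (f≤k zero) (∑-≤ (f ∘ suc) (f≤k ∘ suc))

∑-↑ : ∀ m n (f : Fin (m + n) → ℕ) →
      ∑[ i < m + n ] f i ≡ ∑[ i < m ] f (i ↑ˡ n) + ∑[ j < n ] f (m ↑ʳ j)
∑-↑ zero    n f = refl
∑-↑ (suc m) n f = trans (cong (f zero +_) (∑-↑ m n (f ∘ suc))) (sym (+-assoc (f zero) _ _))

∑-combine : ∀ m n (f : Fin (m * n) → ℕ) →
            ∑[ p < m * n ] f p ≡ ∑[ i < m ] ∑[ j < n ] f (combine i j)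
∑-combine zero    n f = refl
∑-combine (suc m) n f =
  trans (∑-↑ n (m * n) f) (cong (∑[ j < n ] f (j ↑ˡ (m * n)) +_) (∑-combine m n (f ∘ (n ↑ʳ_))))

⟦_⟧ : Bool → ℕ
⟦ b ⟧ = if b then 1 else 0

∣p∣≡∑ : ∀ {m} (p : Subset m) → ∣ p ∣ ≡ ∑[ i < m ] ⟦ lookup p i ⟧
∣p∣≡∑ []          = refl
∣p∣≡∑ (true ∷ p)  = cong suc (∣p∣≡∑ p)
∣p∣≡∑ (false ∷ p) = ∣p∣≡∑ p

module _ {v : ℕ} {G : Graph v} where

  start∈verts : ∀ {a b} (w : Walk G a b) → a ∈ₗ verts w
  start∈verts []      = here refl
  start∈verts (_ ∷ _) = here refl

  suffix-from : ∀ {a b g} (w : Walk G a b) → g ∈ₗ verts w → Σ (Walk G g b) λ w′ → length w′ ≤ length w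
  suffix-from []      (here refl) = [] , z≤n
  suffix-from (e ∷ w) (here refl) = e ∷ w , ≤-refl
  suffix-from (e ∷ w) (there g∈w) with suffix-from w g∈w
  ... | w′ , w′≤w = w′ , m≤n⇒m≤1+n w′≤w

  shortest-start∉tail : ∀ {a b c} (e : G a b ≡ true) (w : Walk G b c) → IsShortest (e ∷ w) → a ∉ₗ verts w
  shortest-start∉tail e w e∷w-shortest a∈w with suffix-from w a∈w
  ... | w′ , w′≤w = <⇒≱ (s≤s w′≤w) (e∷w-shortest w′)

  walk-enters : ∀ {ℓ} {P : Pred (Fin v) ℓ} → Decidable P → ∀ {a b} → Walk G a b → ¬ P a → P b →
                ∃₂ λ z t → ¬ P z × P t × G z t ≡ true
  walk-enters P? []                   ¬Pa Pb = ⊥-elim (¬Pa Pb)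
  walk-enters P? (_∷_ {y = c} e w) ¬Pa Pb with P? c
  ... | yes Pc  = _ , _ , ¬Pa , Pc , e
  ... | no  ¬Pc = walk-enters P? w ¬Pc Pb

Independent : ∀ {v} → Graph v → Subset v → Set
Independent G X = ∀ {a b} → a ∈ X → b ∈ X → ¬ G a b ≡ true

module _ {v : ℕ} {G : Graph v} (simple : IsSimple G) where

  adjacent⇒≢ : ∀ {a b} → G a b ≡ true → ¬ a ≡ b
  adjacent⇒≢ {a} ab refl with trans (sym ab) (proj₂ simple a)
  ... | ()

  adjacent-sym : ∀ {a b} → G a b ≡ true → G b a ≡ true
  adjacent-sym {a} {b} ab = trans (proj₁ simple b a) ab

  module _ (acyclic : Acyclic G) where

    no-triangle : ∀ {a b c} → G a b ≡ true → G b c ≡ true → G c a ≡ true → ⊥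
    no-triangle ab bc ca = acyclic _ (ab ∷ bc ∷ ca ∷ []) (s≤s (s≤s (s≤s z≤n)) ,
      ((adjacent⇒≢ bc ∷ adjacent⇒≢ (adjacent-sym ab) ∷ []) ∷ (adjacent⇒≢ ca ∷ []) ∷ [] ∷ []))

    no-square : ∀ {a b c d} → G a b ≡ true → G b c ≡ true → G c d ≡ true → G d a ≡ true →
                ¬ a ≡ c → ¬ b ≡ d → ⊥
    no-square ab bc cd da a≢c b≢d = acyclic _ (ab ∷ bc ∷ cd ∷ da ∷ []) (s≤s (s≤s (s≤s z≤n)) ,
      ((adjacent⇒≢ bc ∷ b≢d ∷ adjacent⇒≢ (adjacent-sym ab) ∷ []) ∷
       (adjacent⇒≢ cd ∷ a≢c ∘ sym ∷ []) ∷ (adjacent⇒≢ da ∷ []) ∷ [] ∷ []))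

    middle-vertex-blocks : ∀ {X s t z} → t ∈ X → G s t ≡ true → G t z ≡ true → ¬ z ≡ s → ¬ Visible G X s z
    middle-vertex-blocks t∈X st tz z≢s ([] , _ , _) = z≢s refl
    middle-vertex-blocks t∈X st tz z≢s (sz ∷ [] , _ , _) = no-triangle st tz (adjacent-sym sz)
    middle-vertex-blocks {t = t} t∈X st tz z≢s (_∷_ {y = w} sw (wz ∷ []) , _ , _ ∷ w-ok ∷ _) with w ≟ t
    ... | yes refl = [ adjacent⇒≢ st ∘ sym , adjacent⇒≢ tz ]′ (w-ok t∈X)
    ... | no  w≢t  = no-square st tz (adjacent-sym wz) (adjacent-sym sw) (z≢s ∘ sym) (w≢t ∘ sym)
    middle-vertex-blocks t∈X st tz z≢s (_ ∷ _ ∷ _ ∷ _ , shortest , _) with shortest (st ∷ tz ∷ [])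
    ... | s≤s (s≤s ())

third-vertex : ∀ {v} → 3 ≤ v → (x y : Fin v) → ∃ λ u → ¬ u ≡ x × ¬ u ≡ y
third-vertex (s≤s (s≤s (s≤s _))) x y with x ≟ y
... | yes refl = punchIn x zero , punchInᵢ≢i x zero , punchInᵢ≢i x zero
... | no  x≢y  = punchIn x (punchIn y′ zero) , punchInᵢ≢i x _ , u≢y
  where
  y′ = punchOut x≢y
  u≢y : ¬ punchIn x (punchIn y′ zero) ≡ y
  u≢y u≡y = punchInᵢ≢i y′ zero (punchIn-injective x _ _ (trans u≡y (sym (punchIn-punchOut x≢y))))

tree-tmv-independent : ∀ {v} {T : Graph v} {X} → IsTree T → 3 ≤ v → IsTotalMutualVisibility T X → Independent T X
tree-tmv-independent (simple , connected , acyclic) 3≤v tmv {x} {y} x∈X y∈X xy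
  with third-vertex 3≤v x y
... | u , u≢x , u≢y
  with walk-enters (λ g → (g ≟ x) ⊎-dec (g ≟ y)) (connected u y) [ u≢x , u≢y ]′ (inj₂ refl)
... | z , t , z∉xy , inj₁ refl , zt =
  middle-vertex-blocks simple acyclic x∈X (adjacent-sym simple xy) (adjacent-sym simple zt) (z∉xy ∘ inj₂) (tmv y z)
... | z , t , z∉xy , inj₂ refl , zt =
  middle-vertex-blocks simple acyclic y∈X xy (adjacent-sym simple zt) (z∉xy ∘ inj₁) (tmv x z)

module _ {v : ℕ} (G : Graph v) (n : ℕ) where

  adjacent : Fin v × Fin n → Fin v × Fin n → Bool
  adjacent (g , h) (g′ , h′) = (G g g′ ∧ ⌊ h ≟ h′ ⌋) ∨ (⌊ g ≟ g′ ⌋ ∧ not ⌊ h ≟ h′ ⌋)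

  □-adjacent : ∀ p q → (G □ K n) p q ≡ adjacent (remQuot n p) (remQuot n q)
  □-adjacent p q with remQuot {v} n p | remQuot {v} n q
  ... | _ , _ | _ , _ = refl

  data Step : Fin v × Fin n → Fin v × Fin n → Set where
    horizontal : ∀ {g g′ h} → G g g′ ≡ true → Step (g , h) (g′ , h)
    vertical   : ∀ {g h h′} → ¬ h ≡ h′ → Step (g , h) (g , h′)

  adjacent⇒Step : ∀ {c d} → adjacent c d ≡ true → Step c d
  adjacent⇒Step {g , h} {g′ , h′} e with G g g′ in gg′ | h ≟ h′ | g ≟ g′
  ... | true  | yes refl | _        = horizontal gg′
  ... | _     | no  h≢h′ | yes refl = vertical h≢h′
  adjacent⇒Step () | false | yes refl | yes _
  adjacent⇒Step () | false | yes refl | no  _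
  adjacent⇒Step () | true  | no  _    | no  _
  adjacent⇒Step () | false | no  _    | no  _

  Step⇒adjacent : ∀ {c d} → Step c d → adjacent c d ≡ true
  Step⇒adjacent {g , h} (horizontal gg′) with h ≟ h
  ... | yes _   rewrite gg′ = refl
  ... | no  h≢h = ⊥-elim (h≢h refl)
  Step⇒adjacent {g , h} {_ , h′} (vertical h≢h′) with h ≟ h′ | g ≟ g
  ... | yes h≡h′ | _       = ⊥-elim (h≢h′ h≡h′)
  ... | no _     | yes _   = ∨-zeroʳ _
  ... | no _     | no  g≢g = ⊥-elim (g≢g refl)

  edge⇒Step : ∀ {p q} → (G □ K n) p q ≡ true → Step (remQuot n p) (remQuot n q)
  edge⇒Step {p} {q} e = adjacent⇒Step (trans (sym (□-adjacent p q)) e)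

  Step⇒edge : ∀ {g h g′ h′} → Step (g , h) (g′ , h′) → (G □ K n) (combine g h) (combine g′ h′) ≡ true
  Step⇒edge {g} {h} {g′} {h′} s = trans (□-adjacent (combine g h) (combine g′ h′))
    (subst₂ (λ c d → adjacent c d ≡ true) (sym (remQuot-combine g h)) (sym (remQuot-combine g′ h′))
            (Step⇒adjacent s))

  lift : ∀ {a b} → Walk G a b → ∀ h → Walk (G □ K n) (combine a h) (combine b h)
  lift []      h = []
  lift (e ∷ w) h = Step⇒edge (horizontal e) ∷ lift w h

  length-lift : ∀ {a b} (w : Walk G a b) h → length (lift w h) ≡ length w
  length-lift []      h = refl
  length-lift (e ∷ w) h = cong suc (length-lift w h)

  verts-lift : ∀ {a b} (w : Walk G a b) h → verts (lift w h) ≡ map (λ g → combine g h) (verts w)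
  verts-lift {a} []      h = refl
  verts-lift {a} (e ∷ w) h = cong (combine a h ∷_) (verts-lift w h)

  -- Indexed by coordinate pairs rather than by vertices of Fin (v * n), so that matching on the
  -- constructors never has to unify two applications of combine.
  data Projection {p q} (W : Walk (G □ K n) p q) : Fin v × Fin n → Fin v × Fin n → Set where
    leaves-layer : ∀ {x h y h′} (Q : Walk G x y) → length Q < length W → Projection W (x , h) (y , h′)
    inside-layer : ∀ {x h y} (Q : Walk G x y) → length Q ≡ length W →
                   All (λ g → combine g h ∈ₗ verts W) (verts Q) → Projection W (x , h) (y , h)

  remQuot⇒combine : ∀ {p x h} → remQuot {v} n p ≡ (x , h) → combine x h ≡ p
  remQuot⇒combine {p} eq = trans (cong (uncurry combine) (sym eq)) (combine-remQuot {v} n p)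

  project : ∀ {p q} (W : Walk (G □ K n) p q) → Projection W (remQuot n p) (remQuot n q)
  project {p} [] with remQuot {v} n p in eq
  ... | _ , _ = inside-layer [] refl (here (remQuot⇒combine eq) ∷ [])
  project {p} (_∷_ {y = r} e W) with remQuot {v} n p in eq | remQuot {v} n r | edge⇒Step e | project W
  ... | _ | _ | horizontal xx′ | leaves-layer Q Q<W = leaves-layer (xx′ ∷ Q) (s≤s Q<W)
  ... | _ | _ | horizontal xx′ | inside-layer Q Q≡W Q⊆W =
    inside-layer (xx′ ∷ Q) (cong suc Q≡W) (here (remQuot⇒combine eq) ∷ All.map there Q⊆W)
  ... | _ | _ | vertical _ | leaves-layer Q Q<W   = leaves-layer Q (m<n⇒m<1+n Q<W)
  ... | _ | _ | vertical _ | inside-layer Q Q≡W _ = leaves-layer Q (s≤s (≤-reflexive Q≡W))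

  project-combine : ∀ {x h y h′} (W : Walk (G □ K n) (combine x h) (combine y h′)) → Projection W (x , h) (y , h′)
  project-combine {x} {h} {y} {h′} W =
    subst₂ (Projection W) (remQuot-combine x h) (remQuot-combine y h′) (project W)

  module _ {x y} {Q : Walk G x y} (Q-shortest : IsShortest Q) where

    length-□ : ∀ {h h′} (W : Walk (G □ K n) (combine x h) (combine y h′)) → length Q ≤ length W
    length-□ W with project-combine W
    ... | leaves-layer Q′ Q′<W   = ≤-trans (Q-shortest Q′) (<⇒≤ Q′<W)
    ... | inside-layer Q′ Q′≡W _ = ≤-trans (Q-shortest Q′) (≤-reflexive Q′≡W)

    length-□-across : ∀ {h h′} → ¬ h ≡ h′ → (W : Walk (G □ K n) (combine x h) (combine y h′)) → length Q < length W
    length-□-across h≢h′ W with project-combine W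
    ... | leaves-layer Q′ Q′<W = ≤-<-trans (Q-shortest Q′) Q′<W
    ... | inside-layer _ _ _   = ⊥-elim (h≢h′ refl)

    shortest-if-≤ : ∀ {h h′} (P : Walk (G □ K n) (combine x h) (combine y h′)) → length P ≤ length Q → IsShortest P
    shortest-if-≤ P P≤Q W = ≤-trans P≤Q (length-□ W)

    shortest-across-if-≤ : ∀ {h h′} → ¬ h ≡ h′ → (P : Walk (G □ K n) (combine x h) (combine y h′)) →
                           length P ≤ suc (length Q) → IsShortest P
    shortest-across-if-≤ h≢h′ P P≤Q W = ≤-trans P≤Q (length-□-across h≢h′ W)

  layer : Subset (v * n) → Fin n → Subset v
  layer Y h = tabulate (λ g → lookup Y (combine g h))

  layered : Subset v → Subset (v * n)
  layered X = tabulate (λ p → lookup X (proj₁ (remQuot n p)))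

  ∈-layer⁻ : ∀ {Y g h} → g ∈ layer Y h → combine g h ∈ Y
  ∈-layer⁻ {Y} {g} {h} g∈ = lookup⇒[]= _ Y (trans (sym (lookup∘tabulate _ g)) ([]=⇒lookup g∈))

  ∈-layer⁺ : ∀ {Y g h} → combine g h ∈ Y → g ∈ layer Y h
  ∈-layer⁺ {Y} {g} {h} gh∈ = lookup⇒[]= g _ (trans (lookup∘tabulate _ g) ([]=⇒lookup gh∈))

  layer-layered : ∀ X h → layer (layered X) h ≡ X
  layer-layered X h = trans (tabulate-cong λ g →
      trans (lookup∘tabulate _ (combine g h)) (cong (lookup X ∘ proj₁) (remQuot-combine g h)))
    (tabulate∘lookup X)

  ∈-layered⁻ : ∀ {X g h} → combine g h ∈ layered X → g ∈ X
  ∈-layered⁻ {X} {g} {h} gh∈ = subst (g ∈_) (layer-layered X h) (∈-layer⁺ gh∈)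

  ∣∣≡∑∣layer∣ : ∀ Y → ∣ Y ∣ ≡ ∑[ h < n ] ∣ layer Y h ∣
  ∣∣≡∑∣layer∣ Y = begin
    ∣ Y ∣                                                     ≡⟨ ∣p∣≡∑ Y ⟩
    ∑[ p < v * n ] ⟦ lookup Y p ⟧                              ≡⟨ ∑-combine v n _ ⟩
    ∑[ g < v ] ∑[ h < n ] ⟦ lookup Y (combine g h) ⟧           ≡⟨ ∑-comm {v} {n} _ ⟩
    ∑[ h < n ] ∑[ g < v ] ⟦ lookup Y (combine g h) ⟧           ≡⟨ sum-cong-≗ (sym ∘ ∣layer∣) ⟩
    ∑[ h < n ] ∣ layer Y h ∣                                   ∎
    where
    open ≡-Reasoning
    ∣layer∣ : ∀ h → ∣ layer Y h ∣ ≡ ∑[ g < v ] ⟦ lookup Y (combine g h) ⟧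
    ∣layer∣ h = trans (∣p∣≡∑ (layer Y h))
                      (sum-cong-≗ λ g → cong ⟦_⟧ (lookup∘tabulate (λ (g : Fin v) → lookup Y (combine g h)) g))

  shortest-within-layer-≤ : ∀ {x y h} {W : Walk (G □ K n) (combine x h) (combine y h)} →
                            IsShortest W → (Q : Walk G x y) → length W ≤ length Q
  shortest-within-layer-≤ {h = h} W-shortest Q = ≤-trans (W-shortest (lift Q h)) (≤-reflexive (length-lift Q h))

  layer-tmv : ∀ {Y} → IsTotalMutualVisibility (G □ K n) Y → ∀ h → IsTotalMutualVisibility G (layer Y h)
  layer-tmv {Y} Y-tmv h x y with Y-tmv (combine x h) (combine y h)
  ... | W , W-shortest , W-avoids with project-combine W
  ...   | leaves-layer Q Q<W = ⊥-elim (<⇒≱ Q<W (shortest-within-layer-≤ W-shortest Q))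
  ...   | inside-layer Q Q≡W Q⊆W =
    Q , (λ Q′ → ≤-trans (≤-reflexive Q≡W) (shortest-within-layer-≤ W-shortest Q′)) , All.map avoids Q⊆W
    where
    avoids : ∀ {g} → combine g h ∈ₗ verts W → g ∈ layer Y h → g ≡ x ⊎ g ≡ y
    avoids gh∈W g∈ = Sum.map (combine-injectiveˡ _ h x h) (combine-injectiveˡ _ h y h)
                             (All.lookup W-avoids gh∈W (∈-layer⁻ g∈))

  module _ (simple : IsSimple G) {X : Subset v} (X-tmv : IsTotalMutualVisibility G X) (X-independent : Independent G X) where

    lift-avoids : ∀ {a b} (Q : Walk G a b) h {P : Fin (v * n) → Set} →
                  All (λ g → g ∈ X → P (combine g h)) (verts Q) → All (λ p → p ∈ layered X → P p) (verts (lift Q h))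
    lift-avoids Q h avoids rewrite verts-lift Q h = map⁺ (All.map (λ P∘c g∈ → P∘c (∈-layered⁻ g∈)) avoids)

    drop-start : ∀ {x y us} → (∀ {g} → g ∈ₗ us → g ∈ X → ¬ g ≡ x) →
                 All (λ u → u ∈ X → u ≡ x ⊎ u ≡ y) us → All (λ u → u ∈ X → u ≡ y) us
    drop-start ≢x avoids = All.tabulate λ g∈us g∈X →
      [ (λ g≡x → ⊥-elim (≢x g∈us g∈X g≡x)) , id ]′ (All.lookup avoids g∈us g∈X)

    visible-within-layer : ∀ {x y} h → Visible G X x y → Visible (G □ K n) (layered X) (combine x h) (combine y h)
    visible-within-layer h (Q , Q-shortest , Q-avoids) =
      lift Q h ,
      shortest-if-≤ Q-shortest (lift Q h) (≤-reflexive (length-lift Q h)) ,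
      lift-avoids Q h (All.map (λ avoids g∈X → Sum.map (cong (λ g → combine g h)) (cong (λ g → combine g h))
                                                       (avoids g∈X))
                               Q-avoids)

    lift-to-end : ∀ {a y} {p₀} (Q : Walk G a y) h → All (λ u → u ∈ X → u ≡ y) (verts Q) →
                  All (λ p → p ∈ layered X → p ≡ p₀ ⊎ p ≡ combine y h) (verts (lift Q h))
    lift-to-end Q h Q-avoids =
      lift-avoids Q h (All.map (λ avoids g∈X → inj₂ (cong (λ g → combine g h) (avoids g∈X))) Q-avoids)

    visible-across-layers : ∀ {x y h h′} → ¬ h ≡ h′ → Visible G X x y →
                            Visible (G □ K n) (layered X) (combine x h) (combine y h′)
    visible-across-layers {x} {y} {h} {h′} h≢h′ (Q , Q-shortest , Q-avoids) with x ∈? X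
    ... | no x∉X =
      P , shortest-across-if-≤ Q-shortest h≢h′ P (s≤s (≤-reflexive (length-lift Q h′))) ,
      (λ _ → inj₁ refl) ∷ lift-to-end Q h′ (drop-start (λ _ g∈X g≡x → x∉X (subst (_∈ X) g≡x g∈X)) Q-avoids)
      where
      P = Step⇒edge (vertical {x} h≢h′) ∷ lift Q h′
    visible-across-layers {x} h≢h′ ([] , Q-shortest , _) | yes _ =
      P , shortest-across-if-≤ Q-shortest h≢h′ P ≤-refl , (λ _ → inj₁ refl) ∷ (λ _ → inj₂ refl) ∷ []
      where
      P = Step⇒edge (vertical {x} h≢h′) ∷ []
    visible-across-layers {x} {y} {h} {h′} h≢h′ (_∷_ {y = x₁} xx₁ Q , Q-shortest , _ ∷ Q-avoids) | yes x∈X =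
      P , shortest-across-if-≤ {Q = xx₁ ∷ Q} Q-shortest h≢h′ P (s≤s (s≤s (≤-reflexive (length-lift Q h′)))) ,
      (λ _ → inj₁ refl) ∷ (λ x₁h∈ → ⊥-elim (x₁∉X (∈-layered⁻ x₁h∈))) ∷
      lift-to-end Q h′ (drop-start (λ g∈Q _ g≡x → x∉Q (subst (_∈ₗ verts Q) g≡x g∈Q)) Q-avoids)
      where
      P = Step⇒edge (horizontal {h = h} xx₁) ∷ Step⇒edge (vertical {x₁} h≢h′) ∷ lift Q h′
      x∉Q : x ∉ₗ verts Q
      x∉Q = shortest-start∉tail xx₁ Q Q-shortest
      x₁∉X : ¬ x₁ ∈ X
      x₁∉X x₁∈X with All.lookup Q-avoids (start∈verts Q) x₁∈X
      ... | inj₁ refl = adjacent⇒≢ simple xx₁ refl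
      ... | inj₂ refl = X-independent x∈X x₁∈X xx₁

    layered-tmv : IsTotalMutualVisibility (G □ K n) (layered X)
    layered-tmv p q = subst₂ (Visible (G □ K n) (layered X)) (combine-remQuot {v} n p) (combine-remQuot {v} n q)
                             (visible (remQuot n p) (remQuot n q))
      where
      visible : ∀ c d → Visible (G □ K n) (layered X) (uncurry combine c) (uncurry combine d)
      visible (x , h) (y , h′) with h ≟ h′
      ... | yes refl = visible-within-layer h (X-tmv x y)
      ... | no  h≢h′ = visible-across-layers h≢h′ (X-tmv x y)

  ∣layered∣ : ∀ X → ∣ layered X ∣ ≡ n * ∣ X ∣
  ∣layered∣ X = begin
    ∣ layered X ∣                       ≡⟨ ∣∣≡∑∣layer∣ (layered X) ⟩
    ∑[ h < n ] ∣ layer (layered X) h ∣  ≡⟨ sum-cong-≗ (cong ∣_∣ ∘ layer-layered X) ⟩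
    ∑[ h < n ] ∣ X ∣                    ≡⟨ ∑-const n ∣ X ∣ ⟩
    n * ∣ X ∣                           ∎
    where open ≡-Reasoning

corollary4p6 : ∀ {v : ℕ} (T : Graph v) (n k : ℕ) → IsTree T → 3 ≤ v → 1 ≤ n →
    IsMuT T k → IsMuT (T □ K n) (n * k)
corollary4p6 T n k tree@(simple , _ , _) 3≤v _ ((X , X-tmv , ∣X∣≡k) , maximal) =
  (layered T n X , layered-tmv T n simple X-tmv (tree-tmv-independent tree 3≤v X-tmv) ,
   trans (∣layered∣ T n X) (cong (n *_) ∣X∣≡k)) ,
  λ Y Y-tmv → subst (_≤ n * k) (sym (∣∣≡∑∣layer∣ T n Y))
                (∑-≤ (∣_∣ ∘ layer T n Y) (λ h → maximal (layer T n Y h) (layer-tmv T n Y-tmv h)))
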